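{- For any positive integers $r\ge 2$ and $t\ge 3$, $\dim_s(P_r\times K_t)=t\left\lceil\frac{r}{2}\right\rceil$.
   Context: $P_r$ is the path of order $r$ and $K_t$ the complete graph of order $t$. The direct product $G\times H$ has vertex set $V(G)\times V(H)$, with $(a,b)\sim(c,d)$ iff $ac\in E(G)$ and $bd\in E(H)$. For a connected graph $G$, $I_G[u,v]$ is the set of vertices on some shortest $u$–$v$ path. A vertex $w$ strongly resolves $u,v$ if $v\in I_G[u,w]$ or $u\in I_G[v,w]$. A strong resolving set is a set $S\subseteq V(G)$ such that every pair of vertices is strongly resolved by some vertex of $S$; $\dim_s(G)$ is the minimum cardinality of a strong resolving set. -}

module Defs where

open import Data.Nat using (ℕ; zero; suc; _+_; _≤_)
open import Data.Fin using (Fin; toℕ)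
open import Data.Product using (Σ; ∃; _×_; _,_)
open import Data.Sum using (_⊎_)
open import Data.List using (List; length)
open import Data.List.Membership.Propositional using (_∈_)
open import Data.List.Relation.Unary.Unique.Propositional using (Unique)
open import Relation.Binary.PropositionalEquality using (_≡_; _≢_)

data Walk {V : Set} (E : V → V → Set) : V → V → ℕ → Set where
  here : ∀ {u} → Walk E u u zero
  step : ∀ {u w v k} → E u w → Walk E w v k → Walk E u v (suc k)

Dist : {V : Set} → (V → V → Set) → V → V → ℕ → Set
Dist E u v k = Walk E u v k × (∀ m → Walk E u v m → k ≤ m)

InInterval : {V : Set} → (V → V → Set) → V → V → V → Set
InInterval E u v w = ∃ λ a → ∃ λ b → Dist E u w a × Dist E w v b × Dist E u v (a + b)

StronglyResolves : {V : Set} → (V → V → Set) → V → V → V → Set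
StronglyResolves E w u v = InInterval E u w v ⊎ InInterval E v w u

IsStrongResolvingSet : {V : Set} → (V → V → Set) → List V → Set
IsStrongResolvingSet E S =
  ∀ u v → u ≢ v → ∃ λ w → w ∈ S × StronglyResolves E w u v

StrongMetricDimIs : {V : Set} → (V → V → Set) → ℕ → Set
StrongMetricDimIs {V} E k =
  (Σ (List V) λ S → Unique S × IsStrongResolvingSet E S × length S ≡ k)
  × (∀ (S : List V) → Unique S → IsStrongResolvingSet E S → k ≤ length S)

PathAdj : (r : ℕ) → Fin r → Fin r → Set
PathAdj r i j = (suc (toℕ i) ≡ toℕ j) ⊎ (suc (toℕ j) ≡ toℕ i)

CompleteAdj : (t : ℕ) → Fin t → Fin t → Set
CompleteAdj t i j = i ≢ j

DirectProduct : {A B : Set} → (A → A → Set) → (B → B → Set) → (A × B) → (A × B) → Set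
DirectProduct EG EH (a , b) (c , d) = EG a c × EH b d

module Submission where

-- Every step of a walk in P_r × K_t moves in both factors, which makes the distance
-- explicit: rows k ≥ 2 apart are at distance k, and the other cases pay a small
-- detour. In a fixed column, the vertices on adjacent rows, and the two end vertices,
-- are mutually maximally distant, so every strong resolving set contains one vertex
-- of each such pair; these pairs form a cycle of length r through the column, which
-- forces ⌈r/2⌉ vertices per column. Conversely the vertices on even rows form a
-- strong resolving set: a vertex u on an odd row i and a vertex v on an odd row j ≥ i
-- are strongly resolved by a suitable vertex w on row i - 1, as u lies on a shortest
-- v–w path.

open import Defs
open import Data.Bool using (Bool; true; false)
open import Data.Empty using (⊥-elim)
open import Data.Fin using (Fin; zero; suc; toℕ; inject₁; fromℕ; pred; _↑ʳ_; _≟_)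
open import Data.Fin.Properties using (toℕ-inject₁; toℕ-fromℕ; toℕ-injective; toℕ<n)
open import Data.List using (List; []; _∷_; length; map; cartesianProduct; allFin)
open import Data.List.Membership.Propositional using (_∈_)
open import Data.List.Relation.Unary.Any using (here; there)
import Data.List.Relation.Unary.All as All
import Data.List.Relation.Unary.All.Properties as All
open import Data.List.Relation.Unary.Unique.Propositional using (Unique; []; _∷_)
import Data.List.Relation.Unary.Unique.Propositional.Properties as Unique
open import Data.List.Membership.Propositional.Properties
  using (∈-map⁺; ∈-allFin; ∈-cartesianProduct⁺)
open import Data.List.Properties using (length-map; length-++; length-tabulate)
open import Data.Nat using (ℕ; zero; suc; _+_; _*_; _≤_; _<_; z≤n; s≤s; ⌈_/2⌉; ∣_-_∣)
open import Data.Nat.Properties hiding (_≟_)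
open import Algebra.Properties.CommutativeMonoid.Sum +-0-commutativeMonoid
  using (sum; sum-syntax; ∑-distrib-+; sum-init-last; sum-cong-≗; sum-replicate-zero)
open import Data.Product using (∃; _×_; _,_; proj₁; proj₂)
open import Data.Product.Properties using (≡-dec)
open import Data.Sum using (_⊎_; inj₁; inj₂; swap)
open import Relation.Binary.Definitions using (DecidableEquality)
open import Relation.Nullary using (Dec; yes; no; does)
open import Relation.Nullary.Decidable using (dec-true; dec-false)
open import Relation.Binary.PropositionalEquality
open import Function using (_∘_; id)
open import Data.Nat.Tactic.RingSolver using (solve-∀)

module _ {V : Set} {E : V → V → Set} where

  _++ʷ_ : ∀ {u v w m n} → Walk E u v m → Walk E v w n → Walk E u w (m + n)
  here       ++ʷ q = q
  step e p   ++ʷ q = step e (p ++ʷ q)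

  reverseʷ : (∀ {x y} → E x y → E y x) → ∀ {u v m} → Walk E u v m → Walk E v u m
  reverseʷ sym-E here = here
  reverseʷ sym-E (step {k = k} e p) =
    subst (Walk E _ _) (+-comm k 1) (reverseʷ sym-E p ++ʷ step (sym-E e) here)

  there-and-back : (∀ {x y} → E x y → E y x) → ∀ {u v} → E u v → Walk E u u 2
  there-and-back sym-E e = step e (step (sym-E e) here)

module _ {A B : Set} {EA : A → A → Set} {EB : B → B → Set} where

  zipʷ : ∀ {a b c d m} → Walk EA a b m → Walk EB c d m →
         Walk (DirectProduct EA EB) (a , c) (b , d) m
  zipʷ here       here       = here
  zipʷ (step e p) (step f q) = step (e , f) (zipʷ p q)

  unzipʷ : ∀ {u v m} → Walk (DirectProduct EA EB) u v m →
           Walk EA (proj₁ u) (proj₁ v) m × Walk EB (proj₂ u) (proj₂ v) m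
  unzipʷ here             = here , here
  unzipʷ (step (e , f) p) = step e (proj₁ (unzipʷ p)) , step f (proj₂ (unzipʷ p))

module DistanceFunction {V : Set} {E : V → V → Set}
  (d : V → V → ℕ) (d-dist : ∀ u v → Dist E u v (d u v)) where

  Dist⇒≡d : ∀ {u v k} → Dist E u v k → k ≡ d u v
  Dist⇒≡d {u} {v} (p , min) = ≤-antisym (min _ (proj₁ (d-dist u v))) (proj₂ (d-dist u v) _ p)

  d-refl : ∀ v → d v v ≡ 0
  d-refl v = n≤0⇒n≡0 (proj₂ (d-dist v v) 0 here)

  between⇒InInterval : ∀ {u v w} → d u v + d v w ≡ d u w → InInterval E u w v
  between⇒InInterval {u} {v} {w} eq =
    d u v , d v w , d-dist u v , d-dist v w , subst (Dist E u w) (sym eq) (d-dist u w)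

  InInterval⇒between : ∀ {u v w} → InInterval E u w v → d u v + d v w ≡ d u w
  InInterval⇒between (a , b , uv , vw , uw) =
    trans (cong₂ _+_ (sym (Dist⇒≡d uv)) (sym (Dist⇒≡d vw))) (Dist⇒≡d uw)

  endpoint∈interval : ∀ u v → InInterval E u v v
  endpoint∈interval u v = between⇒InInterval (trans (cong (d u v +_) (d-refl v)) (+-identityʳ _))

  MaximallyDistant : V → V → Set
  MaximallyDistant u v = ∀ {x} → E v x → d u x ≤ d u v

  -- If w ≠ v, a shortest v–w walk leaves v through a neighbour x with
  -- d u x ≤ d u v, so d u w < d u v + d v w.
  maximallyDistant⇒interval-end : ∀ {u v w} → MaximallyDistant u v →
    InInterval E u w v → w ≡ v
  maximallyDistant⇒interval-end {u} {v} {w} far int =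
    go (proj₁ (d-dist v w)) (InInterval⇒between int)
    where
    go : ∀ {x b} → Walk E v x b → d u v + b ≡ d u x → x ≡ v
    go here _ = refl
    go {x} {suc b} (step {w = y} e p) eq = ⊥-elim (<-irrefl refl (begin-strict
      d u v + b           <⟨ +-monoʳ-< (d u v) (n<1+n b) ⟩
      d u v + suc b       ≡⟨ eq ⟩
      d u x               ≤⟨ proj₂ (d-dist u x) _ (proj₁ (d-dist u y) ++ʷ p) ⟩
      d u y + b           ≤⟨ +-monoˡ-≤ b (far e) ⟩
      d u v + b           ∎))
      where open ≤-Reasoning

  MutuallyMaximallyDistant : V → V → Set
  MutuallyMaximallyDistant u v = MaximallyDistant u v × MaximallyDistant v u

  mutuallyMaximallyDistant⇒∈ : ∀ {S u v} → IsStrongResolvingSet E S → u ≢ v →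
    MutuallyMaximallyDistant u v → u ∈ S ⊎ v ∈ S
  mutuallyMaximallyDistant⇒∈ {S} res u≢v (far-v , far-u) with res _ _ u≢v
  ... | w , w∈S , inj₁ v∈I = inj₂ (subst (_∈ S) (maximallyDistant⇒interval-end far-v v∈I) w∈S)
  ... | w , w∈S , inj₂ u∈I = inj₁ (subst (_∈ S) (maximallyDistant⇒interval-end far-u u∈I) w∈S)

∑-mono-≤ : ∀ {n} {f g : Fin n → ℕ} → (∀ i → f i ≤ g i) → sum f ≤ sum g
∑-mono-≤ {zero}  f≤g = z≤n
∑-mono-≤ {suc n} f≤g = +-mono-≤ (f≤g zero) (∑-mono-≤ (λ i → f≤g (suc i)))

n*k≤∑ : ∀ {n k} (f : Fin n → ℕ) → (∀ i → k ≤ f i) → n * k ≤ sum f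
n*k≤∑ {zero}  f k≤f = z≤n
n*k≤∑ {suc n} f k≤f = +-mono-≤ (k≤f zero) (n*k≤∑ (λ i → f (suc i)) (λ i → k≤f (suc i)))

∑-≤-suc : ∀ {n} {f g : Fin n → ℕ} (k : Fin n) → (∀ i → i ≢ k → f i ≤ g i) →
  f k ≤ suc (g k) → sum f ≤ suc (sum g)
∑-≤-suc {suc n} zero    f≤g fk≤ = +-mono-≤ fk≤ (∑-mono-≤ (λ i → f≤g (suc i) λ ()))
∑-≤-suc {suc n} {f} {g} (suc k) f≤g fk≤ = subst (sum f ≤_) (+-suc (g zero) _)
  (+-mono-≤ (f≤g zero λ ())
    (∑-≤-suc k (λ i i≢k → f≤g (suc i) (i≢k ∘ Data.Fin.Properties.suc-injective)) fk≤))

-- The n edge inequalities of the cycle on Fin n add up to n ≤ 2 ∑ f.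
cycleCover⇒⌈n/2⌉≤∑ : ∀ {n} (f : Fin n → ℕ) →
  (∀ i j → suc (toℕ i) ≡ toℕ j → 1 ≤ f i + f j) →
  (∀ i j → toℕ i ≡ 0 → suc (toℕ j) ≡ n → 1 ≤ f i + f j) →
  ⌈ n /2⌉ ≤ sum f
cycleCover⇒⌈n/2⌉≤∑ {zero}  f path closing = z≤n
cycleCover⇒⌈n/2⌉≤∑ {suc m} f path closing = begin
  ⌈ suc m /2⌉         ≤⟨ ⌈n/2⌉-mono 1+m≤2∑ ⟩
  ⌈ sum f + sum f /2⌉ ≡⟨ n≡⌈n+n/2⌉ (sum f) ⟨
  sum f               ∎
  where
  open ≤-Reasoning
  first last : ℕ
  first = f zero
  last  = f (fromℕ m)
  init tail : Fin m → ℕ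
  init i = f (inject₁ i)
  tail i = f (suc i)
  path-edges : m ≤ sum init + sum tail
  path-edges = begin
    m                           ≡⟨ *-identityʳ m ⟨
    m * 1                       ≤⟨ n*k≤∑ _ (λ i → path (inject₁ i) (suc i) (cong suc (toℕ-inject₁ i))) ⟩
    sum (λ i → init i + tail i) ≡⟨ ∑-distrib-+ init tail ⟩
    sum init + sum tail         ∎
  closing-edge : 1 ≤ first + last
  closing-edge = closing zero (fromℕ m) refl (cong suc (toℕ-fromℕ m))
  rearrange : ∀ a b c d → (a + b) + (c + d) ≡ (c + b) + (a + d)
  rearrange = solve-∀
  1+m≤2∑ : suc m ≤ sum f + sum f
  1+m≤2∑ = begin
    suc m                                  ≤⟨ +-mono-≤ closing-edge path-edges ⟩
    (first + last) + (sum init + sum tail) ≡⟨ rearrange first last (sum init) (sum tail) ⟩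
    (sum init + last) + (first + sum tail) ≡⟨ cong (_+ sum f) (sum-init-last f) ⟨
    sum f + sum f                          ∎

indicator : ∀ {P : Set} → Dec P → ℕ
indicator (yes _) = 1
indicator (no _)  = 0

indicator≤1 : ∀ {P : Set} (p? : Dec P) → indicator p? ≤ 1
indicator≤1 (yes _) = ≤-refl
indicator≤1 (no _)  = z≤n

indicator-yes : ∀ {P : Set} (p? : Dec P) → P → indicator p? ≡ 1
indicator-yes (yes _) _ = refl
indicator-yes (no ¬p) p = ⊥-elim (¬p p)

indicator-mono : ∀ {P Q : Set} (p? : Dec P) (q? : Dec Q) → (P → Q) → indicator p? ≤ indicator q?
indicator-mono (yes _) (yes _) _   = ≤-refl
indicator-mono (yes p) (no ¬q) P⇒Q = ⊥-elim (¬q (P⇒Q p))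
indicator-mono (no _)  _       _   = z≤n

module Membership {A : Set} (_≟ᴬ_ : DecidableEquality A) where

  open import Data.List.Membership.DecPropositional _≟ᴬ_ using (_∈?_)

  ∈-indicator : List A → A → ℕ
  ∈-indicator S x = indicator (x ∈? S)

  ∈-indicator-∷-≢ : ∀ {y S x} → x ≢ y → ∈-indicator (y ∷ S) x ≤ ∈-indicator S x
  ∈-indicator-∷-≢ {y} {S} {x} x≢y = indicator-mono (x ∈? (y ∷ S)) (x ∈? S) λ
    { (here x≡y)  → ⊥-elim (x≢y x≡y)
    ; (there x∈S) → x∈S
    }

  ∈⊎∈⇒1≤∈-indicator+∈-indicator : ∀ {S x y} → x ∈ S ⊎ y ∈ S →
    1 ≤ ∈-indicator S x + ∈-indicator S y
  ∈⊎∈⇒1≤∈-indicator+∈-indicator {S} {x} (inj₁ x∈S) =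
    ≤-trans (≤-reflexive (sym (indicator-yes (x ∈? S) x∈S))) (m≤m+n _ _)
  ∈⊎∈⇒1≤∈-indicator+∈-indicator {S} {y = y} (inj₂ y∈S) =
    ≤-trans (≤-reflexive (sym (indicator-yes (y ∈? S) y∈S))) (m≤n+m _ _)

module _ {m n : ℕ} where

  open Membership {Fin m × Fin n} (≡-dec _≟_ _≟_) public

  ∑∑-∈-indicator≤length : (S : List (Fin m × Fin n)) →
    ∑[ b < n ] ∑[ a < m ] ∈-indicator S (a , b) ≤ length S
  ∑∑-∈-indicator≤length [] = ≤-reflexive
    (trans (sum-cong-≗ {n} (λ _ → sum-replicate-zero m)) (sum-replicate-zero n))
  ∑∑-∈-indicator≤length (x@(a₀ , b₀) ∷ S) = ≤-trans
    (∑-≤-suc {f = column (x ∷ S)} {g = column S} b₀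
      (λ b b≢b₀ → ∑-mono-≤ {f = row (x ∷ S) b} {g = row S b}
                            (λ a → ∈-indicator-∷-≢ (b≢b₀ ∘ cong proj₂)))
      (∑-≤-suc {f = row (x ∷ S) b₀} {g = row S b₀} a₀
        (λ a a≢a₀ → ∈-indicator-∷-≢ (a≢a₀ ∘ cong proj₁))
        (≤-trans (indicator≤1 _) (s≤s z≤n))))
    (s≤s (∑∑-∈-indicator≤length S))
    where
    row : List (Fin m × Fin n) → Fin n → Fin m → ℕ
    row T b a = ∈-indicator T (a , b)
    column : List (Fin m × Fin n) → Fin n → ℕ
    column T b = sum (row T b)

∣1+m-n∣≡1+∣m-n∣⊎ : ∀ m n → ∣ suc m - n ∣ ≡ suc ∣ m - n ∣ ⊎ ∣ m - n ∣ ≡ suc ∣ suc m - n ∣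
∣1+m-n∣≡1+∣m-n∣⊎ m       zero    = inj₁ (cong suc (sym (∣-∣-identityʳ m)))
∣1+m-n∣≡1+∣m-n∣⊎ zero    (suc n) = inj₂ refl
∣1+m-n∣≡1+∣m-n∣⊎ (suc m) (suc n) = ∣1+m-n∣≡1+∣m-n∣⊎ m n

toℕ-pred : ∀ {n} (i : Fin n) {x} → toℕ i ≡ suc x → toℕ (pred i) ≡ x
toℕ-pred (suc i) refl = toℕ-inject₁ i

module _ {r : ℕ} where

  P : Fin r → Fin r → Set
  P = PathAdj r

  rowDist : Fin r → Fin r → ℕ
  rowDist i j = ∣ toℕ i - toℕ j ∣

  rowDist-offset : ∀ {i j : Fin r} {k} → toℕ i + k ≡ toℕ j → rowDist i j ≡ k
  rowDist-offset {i} {k = k} e = trans (cong (∣ toℕ i -_∣) (sym e)) (∣m-m+n∣≡n (toℕ i) k)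

  rowDist-comm : ∀ (i j : Fin r) → rowDist i j ≡ rowDist j i
  rowDist-comm i j = ∣-∣-comm (toℕ i) (toℕ j)

  rowDist-adjacent : ∀ {i j : Fin r} → P i j → rowDist i j ≡ 1
  rowDist-adjacent {i} {j} (inj₁ e) = rowDist-offset (trans (+-comm (toℕ i) 1) e)
  rowDist-adjacent {i} {j} (inj₂ e) =
    trans (rowDist-comm i j) (rowDist-offset (trans (+-comm (toℕ j) 1) e))

  rowDist<r : ∀ (i j : Fin r) → rowDist i j < r
  rowDist<r i j = ≤-trans (s≤s (∣m-n∣≤m⊔n (toℕ i) (toℕ j))) (⊔-lub (toℕ<n i) (toℕ<n j))

  rowDist-step : ∀ {i w : Fin r} j → P i w →
    rowDist i j ≡ suc (rowDist w j) ⊎ rowDist w j ≡ suc (rowDist i j)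
  rowDist-step {i} {w} j (inj₁ e) = swap
    (subst (λ x → ∣ x - toℕ j ∣ ≡ suc (rowDist i j) ⊎ rowDist i j ≡ suc ∣ x - toℕ j ∣) e
      (∣1+m-n∣≡1+∣m-n∣⊎ (toℕ i) (toℕ j)))
  rowDist-step {i} {w} j (inj₂ e) =
    subst (λ x → ∣ x - toℕ j ∣ ≡ suc (rowDist w j) ⊎ rowDist w j ≡ suc ∣ x - toℕ j ∣) e
      (∣1+m-n∣≡1+∣m-n∣⊎ (toℕ w) (toℕ j))

  path-walk-length : ∀ {i j : Fin r} {m} → Walk P i j m → ∃ λ n → m ≡ rowDist i j + (n + n)
  path-walk-length {i} here = 0 , sym (trans (+-identityʳ _) (∣n-n∣≡0 (toℕ i)))
  path-walk-length {j = j} (step e p) with path-walk-length p | rowDist-step j e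
  ... | n , refl | inj₁ eq = n , cong (_+ (n + n)) (sym eq)
  ... | n , refl | inj₂ eq = suc n , trans (cong (λ x → suc (x + (n + n))) eq) (shift _ n)
    where
    shift : ∀ x n → suc (suc x + (n + n)) ≡ x + (suc n + suc n)
    shift = solve-∀

  descending-walk : ∀ k {i j : Fin r} → toℕ j + k ≡ toℕ i → Walk P i j k
  descending-walk zero {i} {j} e =
    subst (λ x → Walk P i x 0) (toℕ-injective (trans (sym e) (+-identityʳ (toℕ j)))) here
  descending-walk (suc k) {i} {j} e = step (inj₂ down) (descending-walk k (sym pred-i≡j+k))
    where
    i≡1+j+k : toℕ i ≡ suc (toℕ j + k)
    i≡1+j+k = trans (sym e) (+-suc (toℕ j) k)
    pred-i≡j+k : toℕ (pred i) ≡ toℕ j + k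
    pred-i≡j+k = toℕ-pred i i≡1+j+k
    down : suc (toℕ (pred i)) ≡ toℕ i
    down = trans (cong suc pred-i≡j+k) (sym i≡1+j+k)

  path-walk : ∀ (i j : Fin r) → Walk P i j (rowDist i j)
  path-walk i j with ≤-total (toℕ i) (toℕ j)
  ... | inj₁ i≤j = let k , e = m≤n⇒∃[o]m+o≡n i≤j in
    subst (Walk P i j) (sym (rowDist-offset e)) (reverseʷ swap (descending-walk k e))
  ... | inj₂ j≤i = let k , e = m≤n⇒∃[o]m+o≡n j≤i in
    subst (Walk P i j) (sym (trans (rowDist-comm i j) (rowDist-offset e))) (descending-walk k e)

  neighbour : 2 ≤ r → ∀ i → ∃ (P i)
  neighbour (s≤s (s≤s z≤n)) zero = suc zero , inj₁ refl
  neighbour _ (suc i) = inject₁ i , inj₂ (cong suc (toℕ-inject₁ i))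

module _ {t : ℕ} where

  K : Fin t → Fin t → Set
  K = CompleteAdj t

  third-vertex : 3 ≤ t → ∀ (a b : Fin t) → ∃ λ c → c ≢ a × c ≢ b
  third-vertex (s≤s (s≤s (s≤s _))) zero          zero          = suc zero , (λ ()) , (λ ())
  third-vertex (s≤s (s≤s (s≤s _))) zero          (suc zero)    = suc (suc zero) , (λ ()) , (λ ())
  third-vertex (s≤s (s≤s (s≤s _))) zero          (suc (suc _)) = suc zero , (λ ()) , (λ ())
  third-vertex (s≤s (s≤s (s≤s _))) (suc zero)    zero          = suc (suc zero) , (λ ()) , (λ ())
  third-vertex (s≤s (s≤s (s≤s _))) (suc (suc _)) zero          = suc zero , (λ ()) , (λ ())
  third-vertex (s≤s (s≤s (s≤s _))) (suc _)       (suc _)       = zero , (λ ()) , (λ ())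

  complete-walk : 3 ≤ t → ∀ n (a b : Fin t) → Walk K a b (2 + n)
  complete-walk t≥3 zero a b =
    let c , c≢a , c≢b = third-vertex t≥3 a b in step (c≢a ∘ sym) (step c≢b here)
  complete-walk t≥3 (suc n) a b =
    let c , c≢a , _ = third-vertex t≥3 a a in step (c≢a ∘ sym) (complete-walk t≥3 n c b)

  other-column : 3 ≤ t → ∀ (a b : Fin t) → ∃ λ c → c ≢ a × (a ≢ b → c ≡ b)
  other-column t≥3 a b with a ≟ b
  ... | yes a≡b = let c , c≢a , _ = third-vertex t≥3 a a in c , c≢a , λ a≢b → ⊥-elim (a≢b a≡b)
  ... | no a≢b  = b , a≢b ∘ sym , λ _ → refl

parity : ∀ n → ∃ λ p → n ≡ p + p ⊎ n ≡ suc (p + p)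
parity zero = 0 , inj₁ refl
parity (suc n) with parity n
... | p , inj₁ n≡2p   = p , inj₂ (cong suc n≡2p)
... | p , inj₂ n≡2p+1 = suc p , inj₁ (trans (cong suc n≡2p+1) (cong suc (sym (+-suc p p))))

1+2p+2k≡1+2[p+k] : ∀ p k → suc (p + p) + (k + k) ≡ suc ((p + k) + (p + k))
1+2p+2k≡1+2[p+k] = solve-∀

evens : ∀ n → List (Fin n)
evens zero          = []
evens (suc zero)    = zero ∷ []
evens (suc (suc n)) = zero ∷ map (2 ↑ʳ_) (evens n)

length-evens : ∀ n → length (evens n) ≡ ⌈ n /2⌉
length-evens zero          = refl
length-evens (suc zero)    = refl
length-evens (suc (suc n)) = cong suc (trans (length-map (2 ↑ʳ_) (evens n)) (length-evens n))

evens-unique : ∀ n → Unique (evens n)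
evens-unique zero          = []
evens-unique (suc zero)    = All.[] ∷ []
evens-unique (suc (suc n)) =
  All.map⁺ (All.universal (λ _ ()) (evens n)) ∷ Unique.map⁺ suc-suc-injective (evens-unique n)
  where
  suc-suc-injective : ∀ {i j : Fin n} → suc (suc i) ≡ suc (suc j) → i ≡ j
  suc-suc-injective refl = refl

∈-evens : ∀ {n} (i : Fin n) p → toℕ i ≡ p + p → i ∈ evens n
∈-evens {suc zero}    zero          _ _ = here refl
∈-evens {suc (suc n)} zero          _ _ = here refl
∈-evens {suc (suc n)} (suc zero)    (suc p) e = ⊥-elim (0≢1+n (trans (suc-injective e) (+-suc p p)))
∈-evens {suc (suc n)} (suc (suc i)) (suc p) e =
  there (∈-map⁺ (2 ↑ʳ_) (∈-evens i p (suc-injective (trans (suc-injective e) (+-suc p p)))))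

length-cartesianProduct : ∀ {A B : Set} (xs : List A) (ys : List B) →
  length (cartesianProduct xs ys) ≡ length xs * length ys
length-cartesianProduct []       ys = refl
length-cartesianProduct (x ∷ xs) ys = trans (length-++ (map (x ,_) ys))
  (cong₂ _+_ (length-map (x ,_) ys) (length-cartesianProduct xs ys))

-- The distance in P_r × K_t (r ≥ 2, t ≥ 3) between vertices k rows apart, in the
-- same column iff the flag is true: every step moves in both factors, walks in P_r
-- between rows k apart have length k + 2n, and walks in K_t cannot have length 0
-- between distinct columns or length 1 within a column.
productDistance : ℕ → Bool → ℕ
productDistance zero          true  = 0
productDistance zero          false = 2
productDistance (suc zero)    true  = 3
productDistance (suc zero)    false = 1
productDistance (suc (suc k)) _     = suc (suc k)

productDistance-≥2 : ∀ {k} s → 2 ≤ k → productDistance k s ≡ k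
productDistance-≥2 s (s≤s (s≤s _)) = refl

productDistance-false-≤ : ∀ {k D} → k ≤ D → 2 ≤ D → productDistance k false ≤ D
productDistance-false-≤ {zero}        _   2≤D = 2≤D
productDistance-false-≤ {suc zero}    k≤D _   = k≤D
productDistance-false-≤ {suc (suc k)} k≤D _   = k≤D

productDistance-even+1 : ∀ k {s s′} → (k ≡ 0 → s ≡ false × s′ ≡ true) →
  productDistance (k + k) s + 1 ≡ productDistance (suc (k + k)) s′
productDistance-even+1 zero h with h refl
... | refl , refl = refl
productDistance-even+1 (suc k) {s} {s′} _ = begin
  productDistance (suc k + suc k) s + 1 ≡⟨ cong (_+ 1) (productDistance-≥2 s 2≤2k) ⟩
  suc k + suc k + 1                     ≡⟨ +-comm _ 1 ⟩
  suc (suc k + suc k)                   ≡⟨ productDistance-≥2 s′ (s≤s (≤-trans (s≤s z≤n) 2≤2k)) ⟨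
  productDistance (suc (suc k + suc k)) s′ ∎
  where
  open ≡-Reasoning
  2≤2k : 2 ≤ suc k + suc k
  2≤2k = s≤s (≤-trans (s≤s z≤n) (m≤n+m (suc k) k))

module PathTimesComplete {r t : ℕ} (r≥2 : 2 ≤ r) (t≥3 : 3 ≤ t) where

  V : Set
  V = Fin r × Fin t

  E : V → V → Set
  E = DirectProduct (PathAdj r) (CompleteAdj t)

  δ : V → V → ℕ
  δ (i , a) (j , b) = productDistance (rowDist i j) (does (a ≟ b))

  δ-walk : ∀ u v → Walk E u v (δ u v)
  δ-walk (i , a) (j , b) = go (path-walk i j) (a ≟ b)
    where
    bounce : ∀ x → Walk P x x 2
    bounce x = there-and-back swap (proj₂ (neighbour r≥2 x))
    go : ∀ {k} → Walk P i j k → (s : Dec (a ≡ b)) →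
      Walk E (i , a) (j , b) (productDistance k (does s))
    go here                   (yes refl) = here
    go here                   (no a≢b)   = zipʷ (bounce i) (complete-walk t≥3 0 a b)
    go p@(step _ here)        (yes refl) = zipʷ (p ++ʷ bounce j) (complete-walk t≥3 1 a a)
    go p@(step _ here)        (no a≢b)   = zipʷ p (step a≢b here)
    go p@(step _ (step _ _))  _          = zipʷ p (complete-walk t≥3 _ a b)

  productDistance-≤-walk : ∀ {a b : Fin t} k n (s : Dec (a ≡ b)) →
    Walk K a b (k + (n + n)) → productDistance k (does s) ≤ k + (n + n)
  productDistance-≤-walk 0             n       (yes _)    _               = z≤n
  productDistance-≤-walk 0             zero    (no a≢b)   here            = ⊥-elim (a≢b refl)
  productDistance-≤-walk 0             (suc n) (no _)     _               =
    s≤s (≤-trans (s≤s z≤n) (m≤n+m (suc n) n))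
  productDistance-≤-walk 1             zero    (yes refl) (step a≢a here) = ⊥-elim (a≢a refl)
  productDistance-≤-walk 1             (suc n) (yes _)    _               =
    s≤s (s≤s (≤-trans (s≤s z≤n) (m≤n+m (suc n) n)))
  productDistance-≤-walk 1             n       (no _)     _               = s≤s z≤n
  productDistance-≤-walk (suc (suc k)) n       _          _               = m≤m+n _ _

  δ-minimal : ∀ u v m → Walk E u v m → δ u v ≤ m
  δ-minimal (i , a) (j , b) m w with unzipʷ w
  ... | p , q with path-walk-length p
  ... | n , refl = productDistance-≤-walk (rowDist i j) n (a ≟ b) q

  δ-dist : ∀ u v → Dist E u v (δ u v)
  δ-dist u v = δ-walk u v , δ-minimal u v

  open DistanceFunction δ δ-dist public

  sameColumn-far : ∀ {i j a} → 2 ≤ δ (i , a) (j , a) →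
    (∀ {l} → P j l → rowDist i l ≤ δ (i , a) (j , a)) → MaximallyDistant (i , a) (j , a)
  sameColumn-far {i} {a = a} 2≤D bound {l , c} (j~l , a≢c) =
    subst (_≤ _) (cong (productDistance (rowDist i l)) (sym (dec-false (a ≟ c) a≢c)))
      (productDistance-false-≤ (bound j~l) 2≤D)

  adjacentRows-far : ∀ {i j a} → P i j → MaximallyDistant (i , a) (j , a)
  adjacentRows-far {i} {j} {a} i~j = sameColumn-far {i} {j}
    (subst (2 ≤_) (sym D≡3) (s≤s (s≤s z≤n)))
    (λ {l} j~l → subst (rowDist i l ≤_) (sym D≡3) (begin
      rowDist i l               ≤⟨ ∣-∣-triangle (toℕ i) (toℕ j) (toℕ l) ⟩
      rowDist i j + rowDist j l ≡⟨ cong₂ _+_ (rowDist-adjacent i~j) (rowDist-adjacent j~l) ⟩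
      2                         ≤⟨ n≤1+n 2 ⟩
      3                         ∎))
    where
    open ≤-Reasoning
    D≡3 : δ (i , a) (j , a) ≡ 3
    D≡3 = cong₂ productDistance (rowDist-adjacent i~j) (dec-true (a ≟ a) refl)

  adjacentRows-mmd : ∀ {i j a} → P i j → MutuallyMaximallyDistant (i , a) (j , a)
  adjacentRows-mmd {i} {j} i~j =
    adjacentRows-far {i} {j} i~j , adjacentRows-far {j} {i} (swap i~j)

  diametralRows-far : ∀ {i j a} → suc (rowDist i j) ≡ r → 2 ≤ rowDist i j →
    MaximallyDistant (i , a) (j , a)
  diametralRows-far {i} {j} {a} diam 2≤D = sameColumn-far {i} {j}
    (subst (2 ≤_) (sym D≡) 2≤D)
    (λ {l} _ → subst (rowDist i l ≤_) (sym D≡)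
                 (≤-pred (subst (rowDist i l <_) (sym diam) (rowDist<r i l))))
    where
    D≡ : δ (i , a) (j , a) ≡ rowDist i j
    D≡ = productDistance-≥2 (does (a ≟ a)) 2≤D

  diametralRows-mmd : ∀ {i j a} → suc (rowDist i j) ≡ r → 2 ≤ rowDist i j →
    MutuallyMaximallyDistant (i , a) (j , a)
  diametralRows-mmd {i} {j} diam 2≤D =
    diametralRows-far {i} {j} diam 2≤D ,
    diametralRows-far {j} {i} (subst (λ x → suc x ≡ r) (rowDist-comm i j) diam)
                              (subst (2 ≤_) (rowDist-comm i j) 2≤D)

  endRows-mmd : ∀ {i j a} → toℕ i ≡ 0 → suc (toℕ j) ≡ r → MutuallyMaximallyDistant (i , a) (j , a)
  endRows-mmd {i} {j} i≡0 j+1≡r = by-row (toℕ j) refl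
    where
    rowDist-ij : rowDist i j ≡ toℕ j
    rowDist-ij = rowDist-offset (cong (_+ toℕ j) i≡0)
    by-row : ∀ {a} k → toℕ j ≡ k → MutuallyMaximallyDistant (i , a) (j , a)
    by-row zero          j≡0 = ⊥-elim (<-irrefl (trans (cong suc (sym j≡0)) j+1≡r) r≥2)
    by-row (suc zero)    j≡1 = adjacentRows-mmd (inj₁ (trans (cong suc i≡0) (sym j≡1)))
    by-row (suc (suc k)) j≡k = diametralRows-mmd (trans (cong suc rowDist-ij) j+1≡r)
      (subst (2 ≤_) (sym (trans rowDist-ij j≡k)) (s≤s (s≤s z≤n)))

  column-bound : ∀ {S} → IsStrongResolvingSet E S → ∀ a →
    ⌈ r /2⌉ ≤ ∑[ i < r ] ∈-indicator S (i , a)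
  column-bound {S} res a = cycleCover⇒⌈n/2⌉≤∑ _
    (λ i j i+1≡j → covered (λ i≡j → 1+n≢n (trans i+1≡j (cong toℕ (sym i≡j))))
                           (adjacentRows-mmd (inj₁ i+1≡j)))
    (λ i j i≡0 j+1≡r → covered
      (λ i≡j → <-irrefl (trans (cong suc (sym i≡0)) (trans (cong (suc ∘ toℕ) i≡j) j+1≡r)) r≥2)
      (endRows-mmd i≡0 j+1≡r))
    where
    covered : ∀ {i j} → i ≢ j → MutuallyMaximallyDistant (i , a) (j , a) →
      1 ≤ ∈-indicator S (i , a) + ∈-indicator S (j , a)
    covered i≢j mmd = ∈⊎∈⇒1≤∈-indicator+∈-indicator
      (mutuallyMaximallyDistant⇒∈ res (i≢j ∘ cong proj₁) mmd)

  strongResolvingSet⇒t*⌈r/2⌉≤length : ∀ S → IsStrongResolvingSet E S → t * ⌈ r /2⌉ ≤ length S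
  strongResolvingSet⇒t*⌈r/2⌉≤length S res =
    ≤-trans (n*k≤∑ _ (column-bound res)) (∑∑-∈-indicator≤length S)

  evenRows : List V
  evenRows = cartesianProduct (evens r) (allFin t)

  evenRows-unique : Unique evenRows
  evenRows-unique = Unique.cartesianProduct⁺ (evens-unique r) (Unique.allFin⁺ t)

  length-evenRows : length evenRows ≡ t * ⌈ r /2⌉
  length-evenRows = begin
    length evenRows                      ≡⟨ length-cartesianProduct (evens r) (allFin t) ⟩
    length (evens r) * length (allFin t) ≡⟨ cong₂ _*_ (length-evens r) (length-tabulate {n = t} id) ⟩
    ⌈ r /2⌉ * t                          ≡⟨ *-comm ⌈ r /2⌉ t ⟩
    t * ⌈ r /2⌉                          ∎
    where open ≡-Reasoning

  ∈-evenRows : ∀ {i} c p → toℕ i ≡ p + p → (i , c) ∈ evenRows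
  ∈-evenRows c p i≡2p = ∈-cartesianProduct⁺ (∈-evens _ p i≡2p) (∈-allFin c)

  lowerRow-resolves : ∀ {i j l : Fin r} {a b c} k → toℕ i ≡ suc (toℕ l) → toℕ i + (k + k) ≡ toℕ j →
    (i , a) ≢ (j , b) → c ≢ a → (a ≢ b → c ≡ b) → InInterval E (j , b) (l , c) (i , a)
  lowerRow-resolves {i} {j} {l} {a} {b} {c} k i≡l+1 i+2k≡j u≢v c≢a c≡b = between⇒InInterval (begin
    δ (j , b) (i , a) + δ (i , a) (l , c)
      ≡⟨ cong₂ _+_ (cong (λ x → productDistance x (does (b ≟ a))) rowDist-ji)
                   (cong₂ productDistance rowDist-il (dec-false (a ≟ c) (c≢a ∘ sym))) ⟩
    productDistance (k + k) (does (b ≟ a)) + 1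
      ≡⟨ productDistance-even+1 k same-row ⟩
    productDistance (suc (k + k)) (does (b ≟ c))
      ≡⟨ cong (λ x → productDistance x (does (b ≟ c))) rowDist-jl ⟨
    δ (j , b) (l , c) ∎)
    where
    open ≡-Reasoning
    rowDist-ji : rowDist j i ≡ k + k
    rowDist-ji = trans (rowDist-comm j i) (rowDist-offset {i = i} i+2k≡j)
    rowDist-il : rowDist i l ≡ 1
    rowDist-il = trans (rowDist-comm i l)
      (rowDist-offset {i = l} (trans (+-comm (toℕ l) 1) (sym i≡l+1)))
    rowDist-jl : rowDist j l ≡ suc (k + k)
    rowDist-jl = trans (rowDist-comm j l) (rowDist-offset {i = l}
      (trans (+-suc (toℕ l) (k + k)) (trans (cong (_+ (k + k)) (sym i≡l+1)) i+2k≡j)))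
    same-row : k ≡ 0 → does (b ≟ a) ≡ false × does (b ≟ c) ≡ true
    same-row refl = dec-false (b ≟ a) (a≢b ∘ sym) , dec-true (b ≟ c) (sym (c≡b a≢b))
      where
      a≢b : a ≢ b
      a≢b a≡b = u≢v (cong₂ _,_ (toℕ-injective (trans (sym (+-identityʳ (toℕ i))) i+2k≡j)) a≡b)

  oddRows-resolved : ∀ {i j : Fin r} {a b p q} → toℕ i ≡ suc (p + p) → toℕ j ≡ suc (q + q) →
    p ≤ q → (i , a) ≢ (j , b) → ∃ λ w → w ∈ evenRows × InInterval E (j , b) w (i , a)
  oddRows-resolved {i} {j} {a} {b} {p} i≡2p+1 j≡2q+1 p≤q u≢v
    with k , refl ← m≤n⇒∃[o]m+o≡n p≤q | c , c≢a , c≡b ← other-column t≥3 a b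
    = (pred i , c) , ∈-evenRows c p pred-i≡2p ,
      lowerRow-resolves k (trans i≡2p+1 (cong suc (sym pred-i≡2p)))
        (trans (cong (_+ (k + k)) i≡2p+1) (trans (1+2p+2k≡1+2[p+k] p k) (sym j≡2q+1)))
        u≢v c≢a c≡b
    where
    pred-i≡2p : toℕ (pred i) ≡ p + p
    pred-i≡2p = toℕ-pred i i≡2p+1

  evenRows-resolving : IsStrongResolvingSet E evenRows
  evenRows-resolving (i , a) (j , b) u≢v with parity (toℕ i) | parity (toℕ j)
  ... | p , inj₁ i≡2p | _            = (i , a) , ∈-evenRows a p i≡2p , inj₂ (endpoint∈interval _ _)
  ... | _ , inj₂ _    | q , inj₁ j≡2q = (j , b) , ∈-evenRows b q j≡2q , inj₁ (endpoint∈interval _ _)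
  ... | p , inj₂ i≡2p+1 | q , inj₂ j≡2q+1 with ≤-total p q
  ... | inj₁ p≤q = let w , w∈ , u∈I = oddRows-resolved i≡2p+1 j≡2q+1 p≤q u≢v
                   in w , w∈ , inj₂ u∈I
  ... | inj₂ q≤p = let w , w∈ , v∈I = oddRows-resolved j≡2q+1 i≡2p+1 q≤p (u≢v ∘ sym)
                   in w , w∈ , inj₁ v∈I

  strongMetricDim : StrongMetricDimIs E (t * ⌈ r /2⌉)
  strongMetricDim = (evenRows , evenRows-unique , evenRows-resolving , length-evenRows) ,
                    λ S _ → strongResolvingSet⇒t*⌈r/2⌉≤length S

theorem37 : ∀ (r t : ℕ) → 2 ≤ r → 3 ≤ t →
    StrongMetricDimIs (DirectProduct (PathAdj r) (CompleteAdj t)) (t * ⌈ r /2⌉)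
theorem37 r t r≥2 t≥3 = PathTimesComplete.strongMetricDim r≥2 t≥3
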